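{- There is a computable graph $G$ such that every connected component of $G$ computes (and is thus Turing equivalent to) $\emptyset'$.
   Context: A computable graph is a graph $(V,E)$ with $V=\mathbb{N}$ and $E$ a computable set of unordered pairs. A connected component of $G$ is a set $C\subseteq V$ such that any two elements of $C$ are joined by a finite path and $C$ is closed under path connectedness (if $x\in C$ and there is a path from $x$ to $y$, then $y\in C$). -}

module Defs where

open import Data.Nat using (ℕ; zero; suc; _+_; _<_)
open import Data.Nat.DivMod using (_/_; _%_)
open import Data.Bool using (Bool; true; false)
open import Data.Product using (Σ; ∃; ∃-syntax; _×_; _,_; proj₁; proj₂)
open import Data.Empty using (⊥)
open import Relation.Nullary using (¬_)
open import Relation.Binary.PropositionalEquality using (_≡_)
open import Relation.Binary.Construct.Closure.ReflexiveTransitive using (Star)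
open import Function.Bundles using (_⇔_)

tri : ℕ → ℕ
tri zero    = zero
tri (suc s) = tri s + suc s

⟪_,_⟫ : ℕ → ℕ → ℕ
⟪ x , y ⟫ = tri (x + y) + x

-- enumeration (0,0),(0,1),(1,0),(0,2),(1,1),(2,0),... ; inverse of ⟪_,_⟫
next : ℕ × ℕ → ℕ × ℕ
next (x , zero)  = (zero , suc x)
next (x , suc y) = (suc x , y)

unpair : ℕ → ℕ × ℕ
unpair zero    = (zero , zero)
unpair (suc n) = next (unpair n)

-- Oracle (unary, with pairing) partial recursive functions

data Prog : Set where
  zer  : Prog
  sucP : Prog
  fstP : Prog
  sndP : Prog
  orc  : Prog
  comp : Prog → Prog → Prog
  pairP : Prog → Prog → Prog
  prec : Prog → Prog → Prog
  mu   : Prog → Prog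

bit : Bool → ℕ
bit true  = 1
bit false = 0

data Eval (χ : ℕ → Bool) : Prog → ℕ → ℕ → Set where
  e-zer  : ∀ {x} → Eval χ zer x 0
  e-suc  : ∀ {x} → Eval χ sucP x (suc x)
  e-fst  : ∀ {z x y} → z ≡ ⟪ x , y ⟫ → Eval χ fstP z x
  e-snd  : ∀ {z x y} → z ≡ ⟪ x , y ⟫ → Eval χ sndP z y
  e-orc  : ∀ {x} → Eval χ orc x (bit (χ x))
  e-comp : ∀ {f g x w v} → Eval χ g x w → Eval χ f w v → Eval χ (comp f g) x v
  e-pair : ∀ {f g x a b} → Eval χ f x a → Eval χ g x b → Eval χ (pairP f g) x ⟪ a , b ⟫
  e-prec0 : ∀ {f g z x v} → z ≡ ⟪ x , 0 ⟫ → Eval χ f x v → Eval χ (prec f g) z v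
  e-precS : ∀ {f g z x n w v} → z ≡ ⟪ x , suc n ⟫ →
            Eval χ (prec f g) ⟪ x , n ⟫ w →
            Eval χ g ⟪ ⟪ x , n ⟫ , w ⟫ v →
            Eval χ (prec f g) z v
  e-mu   : ∀ {f x n} → Eval χ f ⟪ x , n ⟫ 0 →
           (∀ m → m < n → ∃[ k ] Eval χ f ⟪ x , m ⟫ (suc k)) →
           Eval χ (mu f) x n

-- the empty oracle (unrelativized computation)
∅ : ℕ → Bool
∅ _ = false

-- Gödel numbering of programs (total, surjective decoding)

decode′ : ℕ → ℕ → Prog
decode′ zero    _ = zer
decode′ (suc k) n with n % 9
... | 0 = zer
... | 1 = sucP
... | 2 = fstP
... | 3 = sndP
... | 4 = orc
... | 5 = comp  (decode′ k (proj₁ (unpair (n / 9)))) (decode′ k (proj₂ (unpair (n / 9))))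
... | 6 = pairP (decode′ k (proj₁ (unpair (n / 9)))) (decode′ k (proj₂ (unpair (n / 9))))
... | 7 = prec  (decode′ k (proj₁ (unpair (n / 9)))) (decode′ k (proj₂ (unpair (n / 9))))
... | _ = mu (decode′ k (n / 9))

decode : ℕ → Prog
decode n = decode′ n n

Halts : ℕ → ℕ → Set
Halts e x = ∃[ v ] Eval ∅ (decode e) x v

∅′ : ℕ → Set
∅′ e = Halts e e

Computes : (ℕ → Bool) → (ℕ → Set) → Set
Computes χ P = ∃[ p ] (∀ n → ∃[ b ] (Eval χ p n (bit b) × (b ≡ true ⇔ P n)))

record ComputableGraph (E : ℕ → ℕ → Bool) : Set where
  field
    symmetric   : ∀ x y → E x y ≡ E y x
    irreflexive : ∀ x → E x x ≡ false
    computable  : ∃[ p ] (∀ x y → Eval ∅ p ⟪ x , y ⟫ (bit (E x y)))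

Adj : (ℕ → ℕ → Bool) → ℕ → ℕ → Set
Adj E x y = E x y ≡ true

Path : (ℕ → ℕ → Bool) → ℕ → ℕ → Set
Path E = Star (Adj E)

record IsComponent (E : ℕ → ℕ → Bool) (C : ℕ → Set) : Set where
  field
    nonempty  : ∃[ x ] C x
    connected : ∀ x y → C x → C y → Path E x y
    closed    : ∀ x y → C x → Path E x y → C y

-- Vertex 0 is isolated and every other vertex is child m e s = 1 + ⟪ m , ⟪ e , s ⟫ ⟫.
-- The vertex child m e s is joined to m when φₑ(e) halts within s steps, and child m e 0
-- is joined to every child m e (s + 1). Let n be the least element of a component C.
-- If φₑ(e) halts within s steps, then n, child n e s, child n e 0 is a path. Conversely,
-- the vertices lying (through parents) below some child n e s form a set that can only
-- be left through a halting link, and n is not in it. So e ∈ ∅′ iff child n e 0 ∈ C,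
-- and C computes ∅′ by a μ-search for n followed by one query.
-- The graph is computable because halting within s steps is decided by running an
-- abstract machine for Eval ∅ for s steps, and its step function is primitive
-- recursive: it is written in a small term language that compiles to Prog.

module Submission where

open import Defs
open import Data.Bool using (Bool; true; false; T; not; _∧_; _∨_; if_then_else_)
open import Data.Bool.Properties using (if-float; ∨-comm; T-∨; T-∧; T-≡)
open import Data.Empty using (⊥-elim)
open import Data.List using (List; []; _∷_)
open import Data.Nat using (ℕ; NonZero; zero; suc; _+_; _*_; _∸_; _≤_; _<_; _≡ᵇ_; s≤s; z<s; pred)
open import Data.Nat.DivMod
open import Data.Nat.Divisibility using (divides-refl)
open import Data.Nat.Induction using (<-wellFounded)
open import Data.Nat.Properties
open import Data.Product using (∃-syntax; _×_; _,_; proj₁; proj₂)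
open import Data.Sum using (_⊎_; inj₁; inj₂)
open import Data.Unit using (tt)
open import Function using (_∘_)
open import Function.Bundles using (Equivalence; mk⇔)
open import Induction.WellFounded using (Acc; acc)
open import Relation.Binary.Construct.Closure.ReflexiveTransitive using (ε; _◅_)
open import Relation.Binary.PropositionalEquality

π₁ π₂ : ℕ → ℕ
π₁ n = proj₁ (unpair n)
π₂ n = proj₂ (unpair n)

⟪⟫-next : ∀ p → ⟪ proj₁ (next p) , proj₂ (next p) ⟫ ≡ suc ⟪ proj₁ p , proj₂ p ⟫
⟪⟫-next (x , zero)  =
  trans (+-identityʳ _) (trans (+-suc (tri x) x) (cong (λ t → suc (tri t + x)) (sym (+-identityʳ x))))
⟪⟫-next (x , suc y) = trans (cong (λ t → tri t + suc x) (sym (+-suc x y))) (+-suc (tri (x + suc y)) x)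

⟪π₁,π₂⟫ : ∀ n → ⟪ π₁ n , π₂ n ⟫ ≡ n
⟪π₁,π₂⟫ zero    = refl
⟪π₁,π₂⟫ (suc n) = trans (⟪⟫-next (unpair n)) (cong suc (⟪π₁,π₂⟫ n))

unpair-⟪⟫ : ∀ x y → unpair ⟪ x , y ⟫ ≡ (x , y)
unpair-⟪⟫ x y = by-sum (x + y) x y refl
  where
  by-sum : ∀ s x y → x + y ≡ s → unpair ⟪ x , y ⟫ ≡ (x , y)
  by-sum s       zero    zero    _  = refl
  by-sum s       (suc x) y       eq = trans (cong unpair (⟪⟫-next (x , suc y)))
                                        (cong next (by-sum s x (suc y) (trans (+-suc x y) eq)))
  by-sum (suc s) zero    (suc y) eq = trans (cong unpair (⟪⟫-next (y , zero)))
                                        (cong next (by-sum s y zero (trans (+-identityʳ y) (suc-injective eq))))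

π₁-⟪⟫ : ∀ x y → π₁ ⟪ x , y ⟫ ≡ x
π₁-⟪⟫ x y = cong proj₁ (unpair-⟪⟫ x y)

π₂-⟪⟫ : ∀ x y → π₂ ⟪ x , y ⟫ ≡ y
π₂-⟪⟫ x y = cong proj₂ (unpair-⟪⟫ x y)

m≤⟪m,n⟫ : ∀ m n → m ≤ ⟪ m , n ⟫
m≤⟪m,n⟫ m n = m≤n+m m (tri (m + n))

-- A first-order term language compiled to Prog

-- Terms compute on trees of numbers rather than on their codes, so that the
-- correctness of the terms written below mostly holds by computation.
data Val : Set where
  nat : ℕ → Val
  pr  : Val → Val → Val

code : Val → ℕ
code (nat n)  = n
code (pr a b) = ⟪ code a , code b ⟫

fstᵛ sndᵛ : Val → Val
fstᵛ (nat n)  = nat (π₁ n)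
fstᵛ (pr a b) = a
sndᵛ (nat n)  = nat (π₂ n)
sndᵛ (pr a b) = b

ifzᵛ : ℕ → Val → (ℕ → Val) → Val
ifzᵛ zero    a f = a
ifzᵛ (suc m) a f = f m

iterᵛ : (Val → Val) → ℕ → Val → Val
iterᵛ f zero    a = a
iterᵛ f (suc n) a = f (iterᵛ f n a)

infixr 9 _∘ᵗ_

data Tm : Set where
  idᵗ zeroᵗ              : Tm
  sucᵗ fstᵗ sndᵗ         : Tm → Tm
  oracleᵗ flatᵗ          : Tm → Tm
  pairᵗ _∘ᵗ_             : Tm → Tm → Tm
  ifzᵗ iterᵗ             : Tm → Tm → Tm → Tm

module Semantics (χ : ℕ → Bool) where

  ⟦_⟧ : Tm → Val → Val
  ⟦ idᵗ ⟧         ρ = ρ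
  ⟦ zeroᵗ ⟧       ρ = nat 0
  ⟦ sucᵗ t ⟧      ρ = nat (suc (code (⟦ t ⟧ ρ)))
  ⟦ fstᵗ t ⟧      ρ = fstᵛ (⟦ t ⟧ ρ)
  ⟦ sndᵗ t ⟧      ρ = sndᵛ (⟦ t ⟧ ρ)
  ⟦ oracleᵗ t ⟧   ρ = nat (bit (χ (code (⟦ t ⟧ ρ))))
  ⟦ flatᵗ t ⟧     ρ = nat (code (⟦ t ⟧ ρ))
  ⟦ pairᵗ a b ⟧   ρ = pr (⟦ a ⟧ ρ) (⟦ b ⟧ ρ)
  ⟦ t ∘ᵗ u ⟧      ρ = ⟦ t ⟧ (⟦ u ⟧ ρ)
  ⟦ ifzᵗ c z s ⟧  ρ = ifzᵛ (code (⟦ c ⟧ ρ)) (⟦ z ⟧ ρ) (λ m → ⟦ s ⟧ (pr ρ (nat m)))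
  ⟦ iterᵗ i c b ⟧ ρ = iterᵛ (λ a → ⟦ b ⟧ (pr ρ a)) (code (⟦ c ⟧ ρ)) (⟦ i ⟧ ρ)

idP : Prog
idP = pairP fstP sndP

-- ifzᵗ is primitive recursion that ignores its recursive value.
compile : Tm → Prog
compile idᵗ           = idP
compile zeroᵗ         = zer
compile (sucᵗ t)      = comp sucP (compile t)
compile (fstᵗ t)      = comp fstP (compile t)
compile (sndᵗ t)      = comp sndP (compile t)
compile (oracleᵗ t)   = comp orc (compile t)
compile (flatᵗ t)     = compile t
compile (pairᵗ a b)   = pairP (compile a) (compile b)
compile (t ∘ᵗ u)      = comp (compile t) (compile u)
compile (ifzᵗ c z s)  = comp (prec (compile z) (comp (compile s) fstP)) (pairP idP (compile c))
compile (iterᵗ i c b) = comp (prec (compile i) (comp (compile b) (pairP (comp fstP fstP) sndP)))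
                             (pairP idP (compile c))

module _ (χ : ℕ → Bool) where

  eval-fstP : ∀ n → Eval χ fstP n (π₁ n)
  eval-fstP n = e-fst {y = π₂ n} (sym (⟪π₁,π₂⟫ n))

  eval-sndP : ∀ n → Eval χ sndP n (π₂ n)
  eval-sndP n = e-snd {x = π₁ n} (sym (⟪π₁,π₂⟫ n))

  eval-fst-⟪⟫ : ∀ a b → Eval χ fstP ⟪ a , b ⟫ a
  eval-fst-⟪⟫ a b = e-fst {y = b} refl

  eval-snd-⟪⟫ : ∀ a b → Eval χ sndP ⟪ a , b ⟫ b
  eval-snd-⟪⟫ a b = e-snd {x = a} refl

  eval-idP : ∀ n → Eval χ idP n n
  eval-idP n = subst (Eval χ idP n) (⟪π₁,π₂⟫ n) (e-pair (eval-fstP n) (eval-sndP n))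

  eval-fstᵛ : ∀ v → Eval χ fstP (code v) (code (fstᵛ v))
  eval-fstᵛ (nat n)  = eval-fstP n
  eval-fstᵛ (pr a b) = eval-fst-⟪⟫ (code a) (code b)

  eval-sndᵛ : ∀ v → Eval χ sndP (code v) (code (sndᵛ v))
  eval-sndᵛ (nat n)  = eval-sndP n
  eval-sndᵛ (pr a b) = eval-snd-⟪⟫ (code a) (code b)

  open Semantics χ

  compile-correct : ∀ t ρ → Eval χ (compile t) (code ρ) (code (⟦ t ⟧ ρ))
  compile-correct idᵗ          ρ = eval-idP (code ρ)
  compile-correct zeroᵗ        ρ = e-zer
  compile-correct (sucᵗ t)     ρ = e-comp (compile-correct t ρ) e-suc
  compile-correct (fstᵗ t)     ρ = e-comp (compile-correct t ρ) (eval-fstᵛ (⟦ t ⟧ ρ))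
  compile-correct (sndᵗ t)     ρ = e-comp (compile-correct t ρ) (eval-sndᵛ (⟦ t ⟧ ρ))
  compile-correct (oracleᵗ t)  ρ = e-comp (compile-correct t ρ) e-orc
  compile-correct (flatᵗ t)    ρ = compile-correct t ρ
  compile-correct (pairᵗ a b)  ρ = e-pair (compile-correct a ρ) (compile-correct b ρ)
  compile-correct (t ∘ᵗ u)     ρ = e-comp (compile-correct u ρ) (compile-correct t (⟦ u ⟧ ρ))
  compile-correct (ifzᵗ c z s) ρ =
    e-comp (e-pair (eval-idP (code ρ)) (compile-correct c ρ)) (recursion (code (⟦ c ⟧ ρ)))
    where
    recursion : ∀ n → Eval χ (prec (compile z) (comp (compile s) fstP)) ⟪ code ρ , n ⟫
                             (code (ifzᵛ n (⟦ z ⟧ ρ) (λ m → ⟦ s ⟧ (pr ρ (nat m)))))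
    recursion zero    = e-prec0 {x = code ρ} refl (compile-correct z ρ)
    recursion (suc m) = e-precS {x = code ρ} {n = m} refl (recursion m)
      (e-comp (eval-fst-⟪⟫ ⟪ code ρ , m ⟫ _) (compile-correct s (pr ρ (nat m))))
  compile-correct (iterᵗ i c b) ρ =
    e-comp (e-pair (eval-idP (code ρ)) (compile-correct c ρ)) (recursion (code (⟦ c ⟧ ρ)))
    where
    f : Val → Val
    f a = ⟦ b ⟧ (pr ρ a)
    recursion : ∀ n → Eval χ (prec (compile i) (comp (compile b) (pairP (comp fstP fstP) sndP)))
                             ⟪ code ρ , n ⟫ (code (iterᵛ f n (⟦ i ⟧ ρ)))
    recursion zero    = e-prec0 {x = code ρ} refl (compile-correct i ρ)
    recursion (suc m) = e-precS {x = code ρ} {n = m} refl (recursion m)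
      (e-comp (e-pair (e-comp (eval-fst-⟪⟫ ⟪ code ρ , m ⟫ (code a)) (eval-fst-⟪⟫ (code ρ) m))
                      (eval-snd-⟪⟫ ⟪ code ρ , m ⟫ (code a)))
              (compile-correct b (pr ρ a)))
      where
      a : Val
      a = iterᵛ f m (⟦ i ⟧ ρ)

-- An abstract machine for Eval ∅

-- The address (k , c) stands for decode′ k c; in particular decode e is at (e , e).
Addr : Set
Addr = ℕ × ℕ

prog : Addr → Prog
prog (k , c) = decode′ k c

-- Shape q exhibits the subprograms of q by their addresses, which is what the
-- machine stores in its stack frames.
data Shape : Prog → Set where
  zerˢ  : Shape zer
  sucˢ  : Shape sucP
  fstˢ  : Shape fstP
  sndˢ  : Shape sndP
  orcˢ  : Shape orc
  compˢ : ∀ a b → Shape (comp (prog a) (prog b))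
  pairˢ : ∀ a b → Shape (pairP (prog a) (prog b))
  precˢ : ∀ a b → Shape (prec (prog a) (prog b))
  muˢ   : ∀ a → Shape (mu (prog a))

shape : ∀ k c → Shape (decode′ k c)
shape zero    c = zerˢ
shape (suc k) c with c % 9
... | 0 = zerˢ
... | 1 = sucˢ
... | 2 = fstˢ
... | 3 = sndˢ
... | 4 = orcˢ
... | 5 = compˢ (k , π₁ (c / 9)) (k , π₂ (c / 9))
... | 6 = pairˢ (k , π₁ (c / 9)) (k , π₂ (c / 9))
... | 7 = precˢ (k , π₁ (c / 9)) (k , π₂ (c / 9))
... | suc (suc (suc (suc (suc (suc (suc (suc _))))))) = muˢ (k , c / 9)

data Frame : Set where
  compᶠ  : Addr → Frame
  pair₁ᶠ : Addr → ℕ → Frame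
  pair₂ᶠ : ℕ → Frame
  precᶠ  : Addr → ℕ → ℕ → Frame
  muᶠ    : Addr → ℕ → ℕ → Frame

data State : Set where
  run : Addr → ℕ → List Frame → State
  ret : ℕ → List Frame → State

precStep : Addr → Addr → Addr → ℕ → ℕ → List Frame → State
precStep a b p x zero    K = run a x K
precStep a b p x (suc m) K = run p ⟪ x , m ⟫ (precᶠ b x m ∷ K)

-- The oracle is ∅, so orc returns 0.
stepRun : ∀ {q} → Shape q → Addr → ℕ → List Frame → State
stepRun zerˢ        p x K = ret 0 K
stepRun sucˢ        p x K = ret (suc x) K
stepRun fstˢ        p x K = ret (π₁ x) K
stepRun sndˢ        p x K = ret (π₂ x) K
stepRun orcˢ        p x K = ret 0 K
stepRun (compˢ a b) p x K = run b x (compᶠ a ∷ K)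
stepRun (pairˢ a b) p x K = run a x (pair₁ᶠ b x ∷ K)
stepRun (precˢ a b) p x K = precStep a b p (π₁ x) (π₂ x) K
stepRun (muˢ a)     p x K = run a ⟪ x , 0 ⟫ (muᶠ a x 0 ∷ K)

step : State → State
step (run (k , c) x K)               = stepRun (shape k c) (k , c) x K
step (ret v [])                      = ret v []
step (ret v (compᶠ f ∷ K))           = run f v K
step (ret a (pair₁ᶠ g x ∷ K))        = run g x (pair₂ᶠ a ∷ K)
step (ret b (pair₂ᶠ a ∷ K))          = ret ⟪ a , b ⟫ K
step (ret w (precᶠ g x n ∷ K))       = run g ⟪ ⟪ x , n ⟫ , w ⟫ K
step (ret zero (muᶠ f x n ∷ K))      = ret n K
step (ret (suc _) (muᶠ f x n ∷ K))   = run f ⟪ x , suc n ⟫ (muᶠ f x (suc n) ∷ K)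

steps : ℕ → State → State
steps zero    s = s
steps (suc n) s = steps n (step s)

steps-+ : ∀ m n s → steps (m + n) s ≡ steps n (steps m s)
steps-+ zero    n s = refl
steps-+ (suc m) n s = steps-+ m n (step s)

steps-sucʳ : ∀ n s → steps (suc n) s ≡ step (steps n s)
steps-sucʳ n s = trans (cong (λ m → steps m s) (+-comm 1 n)) (steps-+ n 1 s)

infix 4 _↠_
_↠_ : State → State → Set
s ↠ t = ∃[ n ] steps n s ≡ t

↠-refl : ∀ {s} → s ↠ s
↠-refl = 0 , refl

↠-step : ∀ {s t} → step s ↠ t → s ↠ t
↠-step (n , e) = suc n , e

↠-trans : ∀ {s t u} → s ↠ t → t ↠ u → s ↠ u
↠-trans {s} (m , e) (n , e′) = m + n , trans (steps-+ m n s) (trans (cong (steps n) e) e′)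

↠-cast : ∀ {s t u} → s ≡ t → t ↠ u → s ↠ u
↠-cast refl r = r

precStep-⟪⟫ : ∀ a b p x n K → precStep a b p (π₁ ⟪ x , n ⟫) (π₂ ⟪ x , n ⟫) K ≡ precStep a b p x n K
precStep-⟪⟫ a b p x n K = cong₂ (λ u m → precStep a b p u m K) (π₁-⟪⟫ x n) (π₂-⟪⟫ x n)

mutual
  machine-complete : ∀ {q x v} → Eval ∅ q x v → ∀ p → prog p ≡ q → ∀ K → run p x K ↠ ret v K
  machine-complete d (k , c) refl K = ↠-step (stepRun-complete d (k , c) refl (shape k c) K)

  stepRun-complete : ∀ {q x v} → Eval ∅ q x v → ∀ p → prog p ≡ q → (s : Shape q) → ∀ K →
                     stepRun s p x K ↠ ret v K
  stepRun-complete e-zer p eq zerˢ K = ↠-refl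
  stepRun-complete e-suc p eq sucˢ K = ↠-refl
  stepRun-complete (e-fst {x = x} {y} refl) p eq fstˢ K = 0 , cong (λ u → ret u K) (π₁-⟪⟫ x y)
  stepRun-complete (e-snd {x = x} {y} refl) p eq sndˢ K = 0 , cong (λ u → ret u K) (π₂-⟪⟫ x y)
  stepRun-complete e-orc p eq orcˢ K = ↠-refl
  stepRun-complete (e-comp dg df) p eq (compˢ a b) K =
    ↠-trans (machine-complete dg b refl (compᶠ a ∷ K)) (↠-step (machine-complete df a refl K))
  stepRun-complete (e-pair {x = x} {a = u} df dg) p eq (pairˢ a b) K =
    ↠-trans (machine-complete df a refl (pair₁ᶠ b x ∷ K))
            (↠-step (↠-trans (machine-complete dg b refl (pair₂ᶠ u ∷ K)) (↠-step ↠-refl)))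
  stepRun-complete (e-prec0 {x = x} refl df) p eq (precˢ a b) K =
    ↠-cast (precStep-⟪⟫ a b p x 0 K) (machine-complete df a refl K)
  stepRun-complete (e-precS {x = x} {n} refl dh dg) p eq (precˢ a b) K =
    ↠-cast (precStep-⟪⟫ a b p x (suc n) K)
      (↠-trans (machine-complete dh p eq (precᶠ b x n ∷ K)) (↠-step (machine-complete dg b refl K)))
  stepRun-complete (e-mu {x = x} {n} d0 below) p eq (muˢ a) K = search 0 n refl
    where
    search : ∀ j d → j + d ≡ n → run a ⟪ x , j ⟫ (muᶠ a x j ∷ K) ↠ ret n K
    search j zero    j+0≡n = subst (λ i → run a ⟪ x , i ⟫ (muᶠ a x i ∷ K) ↠ ret n K)
      (sym (trans (sym (+-identityʳ j)) j+0≡n))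
      (↠-trans (machine-complete d0 a refl (muᶠ a x n ∷ K)) (↠-step ↠-refl))
    search j (suc d) j+d+1≡n =
      ↠-trans (machine-complete (proj₂ (below j j<n)) a refl (muᶠ a x j ∷ K))
              (↠-step (search (suc j) d (trans (sym (+-suc j d)) j+d+1≡n)))
      where
      j<n : j < n
      j<n = subst (j <_) j+d+1≡n (m<m+n j z<s)

extend-below : ∀ {ℓ} {P : ℕ → Set ℓ} {j} → (∀ m → m < j → P m) → P j → ∀ m → m < suc j → P m
extend-below below pj m m<1+j with m<1+n⇒m<n∨m≡n m<1+j
... | inj₁ m<j  = below m m<j
... | inj₂ refl = pj

Unwinds : ℕ → Prog → ℕ → List Frame → ℕ → Set
Unwinds n q x K r = ∃[ v ] Eval ∅ q x v × ∃[ m ] m < n × steps m (ret v K) ≡ ret r []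

unwinds-mono : ∀ {n n′ q x K r} → n ≤ n′ → Unwinds n q x K r → Unwinds n′ q x K r
unwinds-mono n≤n′ (v , d , m , m<n , e) = v , d , m , <-≤-trans m<n n≤n′ , e

1+m<n⇒m<1+n : ∀ {m n} → suc m < n → m < suc n
1+m<n⇒m<1+n 1+m<n = m<n⇒m<1+n (<-trans (n<1+n _) 1+m<n)

π₂≡n⇒x≡⟪π₁x,n⟫ : ∀ {x n} → π₂ x ≡ n → x ≡ ⟪ π₁ x , n ⟫
π₂≡n⇒x≡⟪π₁x,n⟫ {x} π₂x≡n = trans (sym (⟪π₁,π₂⟫ x)) (cong ⟪ π₁ x ,_⟫ π₂x≡n)

-- The frames below a subprogram are untouched until it returns, so its run is a
-- strictly shorter prefix of the whole run.
mutual
  machine-sound : ∀ n → Acc _<_ n → ∀ p x K r → steps n (run p x K) ≡ ret r [] → Unwinds n (prog p) x K r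
  machine-sound (suc n) ac (k , c) x K r e = stepRun-sound n ac (k , c) refl (shape k c) x K r e

  stepRun-sound : ∀ n → Acc _<_ (suc n) → ∀ p {q} → prog p ≡ q → (s : Shape q) → ∀ x K r →
             steps n (stepRun s p x K) ≡ ret r [] → Unwinds (suc n) q x K r
  stepRun-sound n _ p eq zerˢ x K r e = 0 , e-zer , n , ≤-refl , e
  stepRun-sound n _ p eq sucˢ x K r e = suc x , e-suc , n , ≤-refl , e
  stepRun-sound n _ p eq fstˢ x K r e = π₁ x , eval-fstP ∅ x , n , ≤-refl , e
  stepRun-sound n _ p eq sndˢ x K r e = π₂ x , eval-sndP ∅ x , n , ≤-refl , e
  stepRun-sound n _ p eq orcˢ x K r e = 0 , e-orc , n , ≤-refl , e
  stepRun-sound n (acc rs) p eq (compˢ a b) x K r e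
    with machine-sound n (rs ≤-refl) b x (compᶠ a ∷ K) r e
  ... | _ , _  , zero  , _     , ()
  ... | w , dg , suc m , 1+m<n , e′ with machine-sound m (rs (1+m<n⇒m<1+n 1+m<n)) a w K r e′
  ... | v , df , m′ , m′<m , e″ = v , e-comp dg df , m′ , <-trans m′<m (1+m<n⇒m<1+n 1+m<n) , e″
  stepRun-sound n (acc rs) p eq (pairˢ a b) x K r e
    with machine-sound n (rs ≤-refl) a x (pair₁ᶠ b x ∷ K) r e
  ... | _ , _  , zero  , _     , ()
  ... | u , df , suc m , 1+m<n , e′ with machine-sound m (rs (1+m<n⇒m<1+n 1+m<n)) b x (pair₂ᶠ u ∷ K) r e′
  ... | _ , _  , zero   , _      , ()
  ... | w , dg , suc m′ , 1+m′<m , e″ =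
    ⟪ u , w ⟫ , e-pair df dg , m′ , <-trans (n<1+n m′) (<-trans 1+m′<m (1+m<n⇒m<1+n 1+m<n)) , e″
  stepRun-sound n (acc rs) p eq (precˢ a b) x K r e with π₂ x in π₂x≡
  ... | zero with machine-sound n (rs ≤-refl) a (π₁ x) K r e
  ...   | v , df , m , m<n , e′ = v , e-prec0 (π₂≡n⇒x≡⟪π₁x,n⟫ π₂x≡) df , m , m<n⇒m<1+n m<n , e′
  stepRun-sound n (acc rs) p eq (precˢ a b) x K r e | suc j
    with machine-sound n (rs ≤-refl) p ⟪ π₁ x , j ⟫ (precᶠ b (π₁ x) j ∷ K) r e
  ... | _ , _  , zero  , _     , ()
  ... | w , dh , suc m , 1+m<n , e′ with machine-sound m (rs (1+m<n⇒m<1+n 1+m<n)) b ⟪ ⟪ π₁ x , j ⟫ , w ⟫ K r e′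
  ... | v , dg , m′ , m′<m , e″ =
    v , e-precS {x = π₁ x} {n = j} (π₂≡n⇒x≡⟪π₁x,n⟫ π₂x≡) (subst (λ q → Eval ∅ q _ _) eq dh) dg , m′ , <-trans m′<m (1+m<n⇒m<1+n 1+m<n) , e″
  stepRun-sound n (acc rs) p eq (muˢ a) x K r e =
    unwinds-mono (n≤1+n n) (mu-sound n (rs ≤-refl) a x 0 K r e (λ _ ()))

  mu-sound : ∀ n → Acc _<_ n → ∀ a x j K r → steps n (run a ⟪ x , j ⟫ (muᶠ a x j ∷ K)) ≡ ret r [] →
             (∀ m → m < j → ∃[ k ] Eval ∅ (prog a) ⟪ x , m ⟫ (suc k)) → Unwinds n (mu (prog a)) x K r
  mu-sound n (acc rs) a x j K r e below with machine-sound n (acc rs) a ⟪ x , j ⟫ (muᶠ a x j ∷ K) r e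
  ... | _     , _ , zero  , _     , ()
  ... | zero  , d , suc m , 1+m<n , e′ = j , e-mu d below , m , <-trans (n<1+n m) 1+m<n , e′
  ... | suc w , d , suc m , 1+m<n , e′
    with mu-sound m (rs (<-trans (n<1+n m) 1+m<n)) a x (suc j) K r e′ (extend-below below (w , d))
  ... | v , dμ , m′ , m′<m , e″ = v , dμ , m′ , <-trans m′<m (<-trans (n<1+n m) 1+m<n) , e″

one : Tm
one = sucᵗ zeroᵗ

lit : ℕ → Tm
lit zero    = zeroᵗ
lit (suc n) = sucᵗ (lit n)

-- de Bruijn-style access: var₀ is the value bound by the innermost ifzᵗ/iterᵗ,
-- t ↑ evaluates t in the environment outside that binder.
var₀ : Tm
var₀ = sndᵗ idᵗ

_↑ : Tm → Tm
t ↑ = t ∘ᵗ fstᵗ idᵗ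

-- Booleans are the numbers bit b.
ifᵗ : Tm → Tm → Tm → Tm
ifᵗ c t f = ifzᵗ c f (t ↑)

isZeroᵗ isSucᵗ : Tm → Tm
isZeroᵗ t = ifzᵗ t one zeroᵗ
isSucᵗ t = ifzᵗ t zeroᵗ one

_∧ᵗ_ _∨ᵗ_ : Tm → Tm → Tm
p ∧ᵗ q = ifᵗ p q zeroᵗ
p ∨ᵗ q = ifᵗ p one q

monusᵗ eqᵗ : Tm → Tm → Tm
monusᵗ a b = iterᵗ (flatᵗ a) b (ifzᵗ var₀ zeroᵗ var₀)
eqᵗ a b = isZeroᵗ (monusᵗ a b) ∧ᵗ isZeroᵗ (monusᵗ b a)

∸-≡ᵇ : ∀ m n → ((m ∸ n) ≡ᵇ 0) ∧ ((n ∸ m) ≡ᵇ 0) ≡ (m ≡ᵇ n)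
∸-≡ᵇ zero    zero    = refl
∸-≡ᵇ zero    (suc n) = refl
∸-≡ᵇ (suc m) zero    = refl
∸-≡ᵇ (suc m) (suc n) = ∸-≡ᵇ m n

module Decision (χ : ℕ → Bool) where
  open Semantics χ

  -- A record rather than an equation, so that t and ρ can be inferred from its type.
  record Decides (t : Tm) (ρ : Val) (b : Bool) : Set where
    constructor decides
    field decided : code (⟦ t ⟧ ρ) ≡ bit b
  open Decides public

  ∘ᵗ-decides : ∀ {t u ρ b} → Decides t (⟦ u ⟧ ρ) b → Decides (t ∘ᵗ u) ρ b
  ∘ᵗ-decides (decides eq) = decides eq

  ifᵗ-correct : ∀ {c ρ b} t f → Decides c ρ b → ⟦ ifᵗ c t f ⟧ ρ ≡ (if b then ⟦ t ⟧ ρ else ⟦ f ⟧ ρ)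
  ifᵗ-correct {b = false} t f (decides eq) rewrite eq = refl
  ifᵗ-correct {b = true}  t f (decides eq) rewrite eq = refl

  isZeroᵗ-correct : ∀ t ρ → Decides (isZeroᵗ t) ρ (code (⟦ t ⟧ ρ) ≡ᵇ 0)
  isZeroᵗ-correct t ρ = decides proof
    where
    proof : code (⟦ isZeroᵗ t ⟧ ρ) ≡ bit (code (⟦ t ⟧ ρ) ≡ᵇ 0)
    proof with code (⟦ t ⟧ ρ)
    ... | zero  = refl
    ... | suc _ = refl

  isSucᵗ-correct : ∀ t ρ → Decides (isSucᵗ t) ρ (not (code (⟦ t ⟧ ρ) ≡ᵇ 0))
  isSucᵗ-correct t ρ = decides proof
    where
    proof : code (⟦ isSucᵗ t ⟧ ρ) ≡ bit (not (code (⟦ t ⟧ ρ) ≡ᵇ 0))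
    proof with code (⟦ t ⟧ ρ)
    ... | zero  = refl
    ... | suc _ = refl

  ∧ᵗ-correct : ∀ {p q ρ a b} → Decides p ρ a → Decides q ρ b → Decides (p ∧ᵗ q) ρ (a ∧ b)
  ∧ᵗ-correct {q = q} {a = false} dp dq = decides (cong code (ifᵗ-correct q zeroᵗ dp))
  ∧ᵗ-correct {q = q} {a = true}  dp dq = decides (trans (cong code (ifᵗ-correct q zeroᵗ dp)) (decided dq))

  ∨ᵗ-correct : ∀ {p q ρ a b} → Decides p ρ a → Decides q ρ b → Decides (p ∨ᵗ q) ρ (a ∨ b)
  ∨ᵗ-correct {q = q} {a = false} dp dq = decides (trans (cong code (ifᵗ-correct one q dp)) (decided dq))
  ∨ᵗ-correct {q = q} {a = true}  dp dq = decides (cong code (ifᵗ-correct one q dp))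
  monusᵗ-correct : ∀ a b ρ → code (⟦ monusᵗ a b ⟧ ρ) ≡ code (⟦ a ⟧ ρ) ∸ code (⟦ b ⟧ ρ)
  monusᵗ-correct a b ρ = cong code (iterate-pred (code (⟦ b ⟧ ρ)))
    where
    iterate-pred : ∀ n → iterᵛ (λ v → ⟦ ifzᵗ var₀ zeroᵗ var₀ ⟧ (pr ρ v)) n (nat (code (⟦ a ⟧ ρ)))
                         ≡ nat (code (⟦ a ⟧ ρ) ∸ n)
    iterate-pred zero    = refl
    iterate-pred (suc n) rewrite iterate-pred n =
      trans (ifz-pred (code (⟦ a ⟧ ρ) ∸ n)) (cong nat (pred[m∸n]≡m∸[1+n] (code (⟦ a ⟧ ρ)) n))
      where
      ifz-pred : ∀ m → ifzᵛ m (nat 0) nat ≡ nat (pred m)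
      ifz-pred zero    = refl
      ifz-pred (suc m) = refl

  eqᵗ-correct : ∀ a b ρ → Decides (eqᵗ a b) ρ (code (⟦ a ⟧ ρ) ≡ᵇ code (⟦ b ⟧ ρ))
  eqᵗ-correct a b ρ = decides (
    trans (decided (∧ᵗ-correct (isZeroᵗ-correct (monusᵗ a b) ρ) (isZeroᵗ-correct (monusᵗ b a) ρ)))
          (cong bit (trans (cong₂ (λ u v → (u ≡ᵇ 0) ∧ (v ≡ᵇ 0)) (monusᵗ-correct a b ρ) (monusᵗ-correct b a ρ))
                           (∸-≡ᵇ (code (⟦ a ⟧ ρ)) (code (⟦ b ⟧ ρ))))))

divmod-unique : ∀ d .{{_ : NonZero d}} q r → r < d → ((r + q * d) / d , (r + q * d) % d) ≡ (q , r)
divmod-unique d q r r<d = cong₂ _,_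
  (trans (+-distrib-/-∣ʳ r (divides-refl q)) (cong₂ _+_ (m<n⇒m/n≡0 r<d) (m*n/n≡m q d)))
  (trans ([m+kn]%n≡m%n r q d) (m<n⇒m%n≡m r<d))

carry9 : ℕ × ℕ → ℕ × ℕ
carry9 (q , r) = if r ≡ᵇ 8 then (suc q , 0) else (q , suc r)

carry9-divmod : ∀ n → carry9 (n / 9 , n % 9) ≡ (suc n / 9 , suc n % 9)
carry9-divmod n =
  subst (λ m → carry9 (n / 9 , n % 9) ≡ (suc m / 9 , suc m % 9)) (sym (m≡m%n+[m/n]*n n 9))
        (carry (n / 9) (n % 9) (m%n<n n 9))
  where
  carry : ∀ q r → r < 9 → carry9 (q , r) ≡ ((suc r + q * 9) / 9 , (suc r + q * 9) % 9)
  carry q r r<9 with r ≡ᵇ 8 in r≡ᵇ8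
  ... | true rewrite ≡ᵇ⇒≡ r 8 (subst T (sym r≡ᵇ8) tt) = sym (divmod-unique 9 (suc q) 0 z<s)
  ... | false = sym (divmod-unique 9 q (suc r) (≤∧≢⇒< r<9 1+r≢9))
    where
    1+r≢9 : suc r ≢ 9
    1+r≢9 1+r≡9 = subst T r≡ᵇ8 (≡⇒≡ᵇ r 8 (suc-injective 1+r≡9))

open Semantics ∅
open Decision ∅

natPair : ℕ × ℕ → Val
natPair (a , b) = pr (nat a) (nat b)

carry9ᵗ divmod9ᵗ : Tm
carry9ᵗ = ifᵗ (eqᵗ r (lit 8)) (pairᵗ (sucᵗ q) zeroᵗ) (pairᵗ q (sucᵗ r))
  where
  q r : Tm
  q = fstᵗ var₀
  r = sndᵗ var₀
divmod9ᵗ = iterᵗ (pairᵗ zeroᵗ zeroᵗ) idᵗ carry9ᵗ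

carry9ᵗ-correct : ∀ ρ q r → ⟦ carry9ᵗ ⟧ (pr ρ (natPair (q , r))) ≡ natPair (carry9 (q , r))
carry9ᵗ-correct ρ q r =
  trans (ifᵗ-correct (pairᵗ (sucᵗ (fstᵗ var₀)) zeroᵗ) (pairᵗ (fstᵗ var₀) (sucᵗ (sndᵗ var₀)))
                     (eqᵗ-correct (sndᵗ var₀) (lit 8) (pr ρ (natPair (q , r)))))
        (sym (if-float natPair (r ≡ᵇ 8)))

divmod9ᵗ-correct : ∀ c → ⟦ divmod9ᵗ ⟧ (nat c) ≡ natPair (c / 9 , c % 9)
divmod9ᵗ-correct c = iteration c
  where
  iteration : ∀ n → iterᵛ (λ v → ⟦ carry9ᵗ ⟧ (pr (nat c) v)) n (natPair (0 , 0)) ≡ natPair (n / 9 , n % 9)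
  iteration zero    = refl
  iteration (suc n) rewrite iteration n =
    trans (carry9ᵗ-correct (nat c) (n / 9) (n % 9)) (cong natPair (carry9-divmod n))

encAddr : Addr → Val
encAddr = natPair

encFrame : Frame → Val
encFrame (compᶠ f)      = pr (nat 0) (encAddr f)
encFrame (pair₁ᶠ g x)   = pr (nat 1) (pr (encAddr g) (nat x))
encFrame (pair₂ᶠ a)     = pr (nat 2) (nat a)
encFrame (precᶠ g x n)  = pr (nat 3) (pr (encAddr g) (natPair (x , n)))
encFrame (muᶠ f x n)    = pr (nat 4) (pr (encAddr f) (natPair (x , n)))

encStack : List Frame → Val
encStack []      = natPair (0 , 0)
encStack (F ∷ K) = pr (nat 1) (pr (encFrame F) (encStack K))

encState : State → Val
encState (run p x K) = pr (nat 0) (pr (encAddr p) (pr (nat x) (encStack K)))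
encState (ret v K)   = pr (nat 1) (pr (nat v) (encStack K))

runᵗ : Tm → Tm → Tm → Tm
runᵗ p x K = pairᵗ zeroᵗ (pairᵗ p (pairᵗ x K))

retᵗ pushᵗ : Tm → Tm → Tm
retᵗ v K = pairᵗ one (pairᵗ v K)
pushᵗ F K = pairᵗ one (pairᵗ F K)

frameᵗ : ℕ → Tm → Tm
frameᵗ tag t = pairᵗ (lit tag) t

outerᵗ : ℕ → Tm
outerᵗ zero    = idᵗ
outerᵗ (suc d) = fstᵗ (outerᵗ d)

-- switchᵗ r b₀ (b₁ ∷ … ∷ bₖ) is bᵢ when r = i, and bₖ when r ≥ k.
switchᵗ : Tm → Tm → List Tm → Tm
switchᵗ r b []        = b
switchᵗ r b (b′ ∷ bs) = ifzᵗ r b (cases 1 b′ bs)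
  where
  cases : ℕ → Tm → List Tm → Tm
  cases depth b []        = b ∘ᵗ outerᵗ depth
  cases depth b (b′ ∷ bs) = ifzᵗ var₀ (b ∘ᵗ outerᵗ depth) (cases (suc depth) b′ bs)

-- The environment is ((p , x , K) , k - 1) , (c / 9 , c % 9), where p = (k , c).
instructionᵗ : Tm
instructionᵗ = switchᵗ r (retᵗ zeroᵗ K)
  ( retᵗ (sucᵗ x) K
  ∷ retᵗ (fstᵗ x) K
  ∷ retᵗ (sndᵗ x) K
  ∷ retᵗ zeroᵗ K
  ∷ runᵗ b x (pushᵗ (frameᵗ 0 a) K)
  ∷ runᵗ a x (pushᵗ (frameᵗ 1 (pairᵗ b x)) K)
  ∷ ifzᵗ (sndᵗ x) (runᵗ a (fstᵗ x) K)
      (runᵗ (p ↑) (flatᵗ recArg) (pushᵗ (frameᵗ 3 (pairᵗ (b ↑) recArg)) (K ↑)))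
  ∷ runᵗ f (flatᵗ firstArg) (pushᵗ (frameᵗ 4 (pairᵗ f firstArg)) K)
  ∷ [])
  where
  u k′ q r p x K a b f recArg firstArg : Tm
  u  = fstᵗ (fstᵗ idᵗ)
  k′ = sndᵗ (fstᵗ idᵗ)
  q  = fstᵗ (sndᵗ idᵗ)
  r  = sndᵗ (sndᵗ idᵗ)
  p  = fstᵗ u
  x  = fstᵗ (sndᵗ u)
  K  = sndᵗ (sndᵗ u)
  a  = pairᵗ k′ (fstᵗ q)
  b  = pairᵗ k′ (sndᵗ q)
  f  = pairᵗ k′ q
  recArg   = pairᵗ (fstᵗ (x ↑)) var₀
  firstArg = pairᵗ x zeroᵗ

-- The environment is (p , x , K).
runStepᵗ : Tm
runStepᵗ = ifzᵗ (fstᵗ (fstᵗ idᵗ)) (retᵗ zeroᵗ (sndᵗ (sndᵗ idᵗ)))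
                (instructionᵗ ∘ᵗ pairᵗ idᵗ (divmod9ᵗ ∘ᵗ sndᵗ (fstᵗ (fstᵗ idᵗ))))

-- The environment is (v , F ∷ K).
popᵗ : Tm
popᵗ = switchᵗ tag (runᵗ d v K)
  ( runᵗ (fstᵗ d) (sndᵗ d) (pushᵗ (frameᵗ 2 v) K)
  ∷ retᵗ (flatᵗ (pairᵗ d v)) K
  ∷ runᵗ (fstᵗ d) (flatᵗ (pairᵗ (sndᵗ d) v)) K
  ∷ ifzᵗ v (retᵗ (sndᵗ (sndᵗ d)) K)
      (runᵗ (fstᵗ (d ↑)) (flatᵗ nextArg) (pushᵗ (frameᵗ 4 (pairᵗ (fstᵗ (d ↑)) nextArg)) (K ↑)))
  ∷ [])
  where
  v F K tag d nextArg : Tm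
  v   = fstᵗ idᵗ
  F   = fstᵗ (sndᵗ (sndᵗ idᵗ))
  K   = sndᵗ (sndᵗ (sndᵗ idᵗ))
  tag = fstᵗ F
  d   = sndᵗ F
  nextArg = pairᵗ (fstᵗ (sndᵗ (d ↑))) (sucᵗ (sndᵗ (sndᵗ (d ↑))))

-- The environment is (v , K).
retStepᵗ : Tm
retStepᵗ = ifzᵗ (fstᵗ (sndᵗ idᵗ)) (pairᵗ one idᵗ) (popᵗ ∘ᵗ fstᵗ idᵗ)

stepᵗ : Tm
stepᵗ = ifzᵗ (fstᵗ idᵗ) (runStepᵗ ∘ᵗ sndᵗ idᵗ) (retStepᵗ ∘ᵗ sndᵗ (fstᵗ idᵗ))

instructionᵗ-correct : ∀ k c x K →
  ⟦ instructionᵗ ⟧ (pr (pr (pr (encAddr (suc k , c)) (pr (nat x) (encStack K))) (nat k)) (natPair (c / 9 , c % 9)))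
  ≡ encState (stepRun (shape (suc k) c) (suc k , c) x K)
instructionᵗ-correct k c x K with c % 9
... | 0 = refl
... | 1 = refl
... | 2 = refl
... | 3 = refl
... | 4 = refl
... | 5 = refl
... | 6 = refl
... | 7 with π₂ x
...   | zero  = refl
...   | suc _ = refl
instructionᵗ-correct k c x K | suc (suc (suc (suc (suc (suc (suc (suc _))))))) = refl

stepᵗ-correct : ∀ s → ⟦ stepᵗ ⟧ (encState s) ≡ encState (step s)
stepᵗ-correct (run (zero , c) x K)          = refl
stepᵗ-correct (run (suc k , c) x K)         =
  trans (cong (λ qr → ⟦ instructionᵗ ⟧ (pr ρ qr)) (divmod9ᵗ-correct c)) (instructionᵗ-correct k c x K)
  where
  ρ : Val
  ρ = pr (pr (encAddr (suc k , c)) (pr (nat x) (encStack K))) (nat k)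
stepᵗ-correct (ret v [])                    = refl
stepᵗ-correct (ret v (compᶠ f ∷ K))         = refl
stepᵗ-correct (ret v (pair₁ᶠ g x ∷ K))      = refl
stepᵗ-correct (ret v (pair₂ᶠ a ∷ K))        = refl
stepᵗ-correct (ret v (precᶠ g x n ∷ K))     = refl
stepᵗ-correct (ret zero (muᶠ f x n ∷ K))    = refl
stepᵗ-correct (ret (suc v) (muᶠ f x n ∷ K)) = refl

start : ℕ → State
start e = run (e , e) e []

halted : State → Bool
halted (run _ _ _)     = false
halted (ret _ [])      = true
halted (ret _ (_ ∷ _)) = false

haltsWithin : ℕ → ℕ → Bool
haltsWithin e s = halted (steps s (start e))

haltsWithin-sound : ∀ e s → T (haltsWithin e s) → Halts e e
haltsWithin-sound e s h with steps s (start e) in eq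
... | ret r [] with machine-sound s (<-wellFounded s) (e , e) e [] r eq
...   | v , d , _ = v , d

haltsWithin-complete : ∀ e → Halts e e → ∃[ s ] T (haltsWithin e s)
haltsWithin-complete e (v , d) with machine-complete d (e , e) refl []
... | s , eq = s , subst (T ∘ halted) (sym eq) tt

haltedᵗ startᵗ haltsWithinᵗ : Tm
haltedᵗ = ifzᵗ (fstᵗ idᵗ) zeroᵗ (isZeroᵗ (fstᵗ (sndᵗ (sndᵗ (fstᵗ idᵗ)))))
startᵗ = runᵗ (pairᵗ e e) e (pairᵗ zeroᵗ zeroᵗ)
  where
  e : Tm
  e = fstᵗ idᵗ
haltsWithinᵗ = haltedᵗ ∘ᵗ iterᵗ startᵗ (sndᵗ idᵗ) (stepᵗ ∘ᵗ var₀)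

haltedᵗ-correct : ∀ s → Decides haltedᵗ (encState s) (halted s)
haltedᵗ-correct (run _ _ _)     = decides refl
haltedᵗ-correct (ret _ [])      = decides refl
haltedᵗ-correct (ret _ (_ ∷ _)) = decides refl

iterate-stepᵗ : ∀ ρ n s → iterᵛ (λ v → ⟦ stepᵗ ∘ᵗ var₀ ⟧ (pr ρ v)) n (encState s) ≡ encState (steps n s)
iterate-stepᵗ ρ zero    s = refl
iterate-stepᵗ ρ (suc n) s =
  trans (cong ⟦ stepᵗ ⟧ (iterate-stepᵗ ρ n s))
        (trans (stepᵗ-correct (steps n s)) (cong encState (sym (steps-sucʳ n s))))

haltsWithinᵗ-correct : ∀ e s → Decides haltsWithinᵗ (natPair (e , s)) (haltsWithin e s)
haltsWithinᵗ-correct e s = ∘ᵗ-decides (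
  subst (λ v → Decides haltedᵗ v (haltsWithin e s)) (sym (iterate-stepᵗ (natPair (e , s)) s (start e)))
        (haltedᵗ-correct (steps s (start e))))

-- The graph

child : ℕ → ℕ → ℕ → ℕ
child m e s = suc ⟪ m , ⟪ e , s ⟫ ⟫

child-unpair : ∀ z {m e s} → π₁ z ≡ m → π₁ (π₂ z) ≡ e → π₂ (π₂ z) ≡ s → child m e s ≡ suc z
child-unpair z refl refl refl = cong suc (trans (cong ⟪ π₁ z ,_⟫ (⟪π₁,π₂⟫ (π₂ z))) (⟪π₁,π₂⟫ z))

child-injective : ∀ {m e s m′ e′ s′} → child m e s ≡ child m′ e′ s′ → m ≡ m′ × e ≡ e′ × s ≡ s′
child-injective {m} {e} {s} {m′} {e′} {s′} eq =
  trans (sym (π₁-⟪⟫ m ⟪ e , s ⟫)) (trans (cong π₁ ⟪⟫≡) (π₁-⟪⟫ m′ ⟪ e′ , s′ ⟫)) ,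
  trans (sym (π₁-⟪⟫ e s)) (trans (cong π₁ rest≡) (π₁-⟪⟫ e′ s′)) ,
  trans (sym (π₂-⟪⟫ e s)) (trans (cong π₂ rest≡) (π₂-⟪⟫ e′ s′))
  where
  ⟪⟫≡ : ⟪ m , ⟪ e , s ⟫ ⟫ ≡ ⟪ m′ , ⟪ e′ , s′ ⟫ ⟫
  ⟪⟫≡ = suc-injective eq
  rest≡ : ⟪ e , s ⟫ ≡ ⟪ e′ , s′ ⟫
  rest≡ = trans (sym (π₂-⟪⟫ m ⟪ e , s ⟫)) (trans (cong π₂ ⟪⟫≡) (π₂-⟪⟫ m′ ⟪ e′ , s′ ⟫))

parent<child : ∀ m e s → m < child m e s
parent<child m e s = s≤s (m≤⟪m,n⟫ m ⟪ e , s ⟫)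

data Link : ℕ → ℕ → Set where
  halting : ∀ {m e s} → T (haltsWithin e s) → Link (child m e s) m
  fan     : ∀ {m e s} → Link (child m e 0) (child m e (suc s))

Link-irreflexive : ∀ {x y} → Link x y → x ≢ y
Link-irreflexive (halting {m} {e} {s} _) eq = <⇒≢ (parent<child m e s) (sym eq)
Link-irreflexive (fan {m} {e} {s}) eq with child-injective {m} {e} {0} {m} {e} {suc s} eq
... | _ , _ , ()

haltLinkᵇ fanLinkᵇ linkᵇ edge : ℕ → ℕ → Bool
haltLinkᵇ z y = (π₁ z ≡ᵇ y) ∧ haltsWithin (π₁ (π₂ z)) (π₂ (π₂ z))
fanLinkᵇ z zero     = false
fanLinkᵇ z (suc z′) = ((π₁ z ≡ᵇ π₁ z′) ∧ (π₁ (π₂ z) ≡ᵇ π₁ (π₂ z′)))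
                     ∧ ((π₂ (π₂ z) ≡ᵇ 0) ∧ not (π₂ (π₂ z′) ≡ᵇ 0))
linkᵇ zero    y = false
linkᵇ (suc z) y = haltLinkᵇ z y ∨ fanLinkᵇ z y
edge x y = linkᵇ x y ∨ linkᵇ y x

T-not-≡ᵇ0 : ∀ n → T (not (n ≡ᵇ 0)) → ∃[ j ] n ≡ suc j
T-not-≡ᵇ0 (suc j) _ = j , refl

haltLinkᵇ-sound : ∀ z y → T (haltLinkᵇ z y) → Link (suc z) y
haltLinkᵇ-sound z y h with Equivalence.to (T-∧ {π₁ z ≡ᵇ y}) h
... | m≡y , halts = subst₂ Link (child-unpair z refl refl refl) (≡ᵇ⇒≡ (π₁ z) y m≡y)
                               (halting {π₁ z} {π₁ (π₂ z)} {π₂ (π₂ z)} halts)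

fanLinkᵇ-sound : ∀ z y → T (fanLinkᵇ z y) → Link (suc z) y
fanLinkᵇ-sound z zero     ()
fanLinkᵇ-sound z (suc z′) h with Equivalence.to (T-∧ {(π₁ z ≡ᵇ π₁ z′) ∧ (π₁ (π₂ z) ≡ᵇ π₁ (π₂ z′))}) h
... | same , ends with Equivalence.to (T-∧ {π₁ z ≡ᵇ π₁ z′}) same | Equivalence.to (T-∧ {π₂ (π₂ z) ≡ᵇ 0}) ends
...   | m≡m′ , e≡e′ | s≡0 , s′≢0 with T-not-≡ᵇ0 (π₂ (π₂ z′)) s′≢0
...     | j , s′≡1+j = subst₂ Link
  (child-unpair z refl refl (≡ᵇ⇒≡ (π₂ (π₂ z)) 0 s≡0))
  (child-unpair z′ (sym (≡ᵇ⇒≡ (π₁ z) (π₁ z′) m≡m′)) (sym (≡ᵇ⇒≡ (π₁ (π₂ z)) (π₁ (π₂ z′)) e≡e′)) s′≡1+j)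
  (fan {π₁ z} {π₁ (π₂ z)} {j})

linkᵇ-sound : ∀ x y → T (linkᵇ x y) → Link x y
linkᵇ-sound (suc z) y h with Equivalence.to (T-∨ {haltLinkᵇ z y}) h
... | inj₁ hl = haltLinkᵇ-sound z y hl
... | inj₂ hf = fanLinkᵇ-sound z y hf

linkᵇ-complete : ∀ {x y} → Link x y → T (linkᵇ x y)
linkᵇ-complete (halting {m} {e} {s} h)
  rewrite π₁-⟪⟫ m ⟪ e , s ⟫ | π₂-⟪⟫ m ⟪ e , s ⟫ | π₁-⟪⟫ e s | π₂-⟪⟫ e s =
  Equivalence.from T-∨ (inj₁ (Equivalence.from T-∧ (≡⇒≡ᵇ m m refl , h)))
linkᵇ-complete (fan {m} {e} {s})
  rewrite π₁-⟪⟫ m ⟪ e , 0 ⟫ | π₂-⟪⟫ m ⟪ e , 0 ⟫ | π₁-⟪⟫ e 0 | π₂-⟪⟫ e 0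
        | π₁-⟪⟫ m ⟪ e , suc s ⟫ | π₂-⟪⟫ m ⟪ e , suc s ⟫ | π₁-⟪⟫ e (suc s) | π₂-⟪⟫ e (suc s) =
  Equivalence.from T-∨ (inj₂ (Equivalence.from T-∧
    (Equivalence.from T-∧ (≡⇒≡ᵇ m m refl , ≡⇒≡ᵇ e e refl) , tt)))

edge-sym : ∀ x y → edge x y ≡ edge y x
edge-sym x y = ∨-comm (linkᵇ x y) (linkᵇ y x)

linkᵇ-irreflexive : ∀ x → linkᵇ x x ≡ false
linkᵇ-irreflexive x with linkᵇ x x in eq
... | false = refl
... | true  = ⊥-elim (Link-irreflexive (linkᵇ-sound x x (subst T (sym eq) tt)) refl)

edge-irreflexive : ∀ x → edge x x ≡ false
edge-irreflexive x rewrite linkᵇ-irreflexive x = refl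

Adj⇒Link : ∀ {x y} → Adj edge x y → Link x y ⊎ Link y x
Adj⇒Link {x} {y} adj with Equivalence.to (T-∨ {linkᵇ x y}) (Equivalence.from T-≡ adj)
... | inj₁ h = inj₁ (linkᵇ-sound x y h)
... | inj₂ h = inj₂ (linkᵇ-sound y x h)

Link⇒Adj : ∀ {x y} → Link y x → Adj edge x y
Link⇒Adj {x} {y} l = Equivalence.to T-≡ (Equivalence.from (T-∨ {linkᵇ x y}) (inj₂ (linkᵇ-complete l)))

haltLinkᵗ fanLinkᵗ linkᵗ edgeᵗ : Tm
haltLinkᵗ = eqᵗ (fstᵗ var₀) (sndᵗ (fstᵗ idᵗ)) ∧ᵗ (haltsWithinᵗ ∘ᵗ pairᵗ (fstᵗ (sndᵗ var₀)) (sndᵗ (sndᵗ var₀)))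
fanLinkᵗ = ifzᵗ (sndᵗ (fstᵗ idᵗ)) zeroᵗ
  (  (eqᵗ (fstᵗ z) (fstᵗ z′) ∧ᵗ eqᵗ (fstᵗ (sndᵗ z)) (fstᵗ (sndᵗ z′)))
  ∧ᵗ (isZeroᵗ (sndᵗ (sndᵗ z)) ∧ᵗ isSucᵗ (sndᵗ (sndᵗ z′))))
  where
  z z′ : Tm
  z  = var₀ ↑
  z′ = var₀
linkᵗ = ifzᵗ (fstᵗ idᵗ) zeroᵗ (haltLinkᵗ ∨ᵗ fanLinkᵗ)
edgeᵗ = linkᵗ ∨ᵗ (linkᵗ ∘ᵗ pairᵗ (sndᵗ idᵗ) (fstᵗ idᵗ))

linkᵗ-correct : ∀ x y → Decides linkᵗ (natPair (x , y)) (linkᵇ x y)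
linkᵗ-correct zero    y = decides refl
linkᵗ-correct (suc z) y = decides (decided (∨ᵗ-correct halt-correct (fan-correct y)))
  where
  ρ : Val
  ρ = pr (natPair (suc z , y)) (nat z)
  halt-correct : Decides haltLinkᵗ ρ (haltLinkᵇ z y)
  halt-correct = ∧ᵗ-correct (eqᵗ-correct (fstᵗ var₀) (sndᵗ (fstᵗ idᵗ)) ρ)
                           (∘ᵗ-decides (haltsWithinᵗ-correct (π₁ (π₂ z)) (π₂ (π₂ z))))
  fan-correct : ∀ y → Decides fanLinkᵗ (pr (natPair (suc z , y)) (nat z)) (fanLinkᵇ z y)
  fan-correct zero     = decides refl
  fan-correct (suc z′) = decides (decided (∧ᵗ-correct
    (∧ᵗ-correct (eqᵗ-correct (fstᵗ (var₀ ↑)) (fstᵗ var₀) ρ′) (eqᵗ-correct (fstᵗ (sndᵗ (var₀ ↑))) (fstᵗ (sndᵗ var₀)) ρ′))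
    (∧ᵗ-correct (isZeroᵗ-correct (sndᵗ (sndᵗ (var₀ ↑))) ρ′) (isSucᵗ-correct (sndᵗ (sndᵗ var₀)) ρ′))))
    where
    ρ′ : Val
    ρ′ = pr (pr (natPair (suc z , suc z′)) (nat z)) (nat z′)

edgeᵗ-correct : ∀ x y → Decides edgeᵗ (natPair (x , y)) (edge x y)
edgeᵗ-correct x y = ∨ᵗ-correct (linkᵗ-correct x y) (∘ᵗ-decides (linkᵗ-correct y x))

edge-computable : ComputableGraph edge
edge-computable = record
  { symmetric   = edge-sym
  ; irreflexive = edge-irreflexive
  ; computable  = compile edgeᵗ , λ x y →
      subst (Eval ∅ (compile edgeᵗ) ⟪ x , y ⟫) (decided (edgeᵗ-correct x y))
            (compile-correct ∅ edgeᵗ (natPair (x , y)))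
  }

data InBranch (n e : ℕ) : ℕ → Set where
  here  : ∀ s → InBranch n e (child n e s)
  there : ∀ {a} b c → InBranch n e a → InBranch n e (child a b c)

InBranch-above : ∀ {n e x} → InBranch n e x → n < x
InBranch-above {n} {e} (here s)         = parent<child n e s
InBranch-above (there {a} b c inBranch) = <-trans (InBranch-above inBranch) (parent<child a b c)

InBranch-child : ∀ {n e} a b c → InBranch n e (child a b c) → (a ≡ n × b ≡ e) ⊎ InBranch n e a
InBranch-child a b c inBranch = invert inBranch refl
  where
  invert : ∀ {n e x a b c} → InBranch n e x → x ≡ child a b c → (a ≡ n × b ≡ e) ⊎ InBranch n e a
  invert {n} {e} {a = a} {b} {c} (here s) eq with child-injective {n} {e} {s} {a} {b} {c} eq
  ... | n≡a , e≡b , _ = inj₁ (sym n≡a , sym e≡b)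
  invert {a = a} {b} {c} (there {a′} b′ c′ inBranch) eq with child-injective {a′} {b′} {c′} {a} {b} {c} eq
  ... | refl , _ , _ = inj₂ inBranch

-- The only way out of a branch is the halting link to its root.
InBranch-link : ∀ {n e x y} → InBranch n e x → Link x y ⊎ Link y x → InBranch n e y ⊎ Halts e e
InBranch-link inBranch (inj₁ (halting {m} {b} {s} h)) with InBranch-child m b s inBranch
... | inj₁ (refl , refl) = inj₂ (haltsWithin-sound _ s h)
... | inj₂ inParent      = inj₁ inParent
InBranch-link inBranch (inj₂ (halting {e = b} {s} _)) = inj₁ (there b s inBranch)
InBranch-link inBranch (inj₁ (fan {m} {b} {s})) with InBranch-child m b 0 inBranch
... | inj₁ (refl , refl) = inj₁ (here (suc s))
... | inj₂ inParent      = inj₁ (there b (suc s) inParent)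
InBranch-link inBranch (inj₂ (fan {m} {b} {s})) with InBranch-child m b (suc s) inBranch
... | inj₁ (refl , refl) = inj₁ (here 0)
... | inj₂ inParent      = inj₁ (there b 0 inParent)

InBranch-path : ∀ {n e x y} → InBranch n e x → Path edge x y → InBranch n e y ⊎ Halts e e
InBranch-path inBranch ε            = inj₁ inBranch
InBranch-path inBranch (adj ◅ path) with InBranch-link inBranch (Adj⇒Link adj)
... | inj₁ inNext = InBranch-path inNext path
... | inj₂ halts  = inj₂ halts

halting⇒path : ∀ n e s → T (haltsWithin e s) → Path edge n (child n e 0)
halting⇒path n e zero    h = Link⇒Adj (halting {n} {e} {0} h) ◅ ε
halting⇒path n e (suc s) h = Link⇒Adj (halting {n} {e} {suc s} h) ◅ Link⇒Adj (fan {n} {e} {s}) ◅ ε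

Least : (ℕ → Bool) → Set
Least χ = ∃[ n ] χ n ≡ true × (∀ m → m < n → χ m ≡ false)

least-or-below : ∀ χ n → Least χ ⊎ (∀ m → m < n → χ m ≡ false)
least-or-below χ zero = inj₂ (λ _ ())
least-or-below χ (suc n) with least-or-below χ n
... | inj₁ found = inj₁ found
... | inj₂ below with χ n in χn
...   | true  = inj₁ (n , χn , below)
...   | false = inj₂ (extend-below below χn)

least : ∀ χ x → χ x ≡ true → Least χ
least χ x χx with least-or-below χ (suc x)
... | inj₁ found = found
... | inj₂ below with trans (sym χx) (below x (n<1+n x))
...   | ()

outsideᵗ : Tm
outsideᵗ = isZeroᵗ (oracleᵗ var₀)

-- e ↦ χ (child n e 0), with n the least element of χ found by μ-search.
rootChildP : Prog
rootChildP = comp orc (comp sucP (pairP (mu (compile outsideᵗ)) (pairP idP zer)))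

rootChildP-correct : ∀ χ → ((n , _) : Least χ) → ∀ e → Eval χ rootChildP e (bit (χ (child n e 0)))
rootChildP-correct χ (n , χn , below) e =
  e-comp (e-comp (e-pair (e-mu (outside-at n χn) (λ m m<n → 0 , outside-at m (below m m<n)))
                         (e-pair (eval-idP χ e) e-zer))
                 e-suc)
         e-orc
  where
  outside-at : ∀ k {b} → χ k ≡ b → Eval χ (compile outsideᵗ) ⟪ e , k ⟫ (bit (not b))
  outside-at k refl = subst (Eval χ (compile outsideᵗ) ⟪ e , k ⟫)
    (trans (Decision.decided (Decision.isZeroᵗ-correct χ (oracleᵗ var₀) (natPair (e , k))))
           (cong bit (bit≡ᵇ0 (χ k))))
    (compile-correct χ outsideᵗ (natPair (e , k)))
    where
    bit≡ᵇ0 : ∀ b → (bit b ≡ᵇ 0) ≡ not b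
    bit≡ᵇ0 true  = refl
    bit≡ᵇ0 false = refl

component-computes-∅′ : ∀ χ → IsComponent edge (λ x → χ x ≡ true) → Computes χ ∅′
component-computes-∅′ χ component with least χ _ (proj₂ (IsComponent.nonempty component))
... | n , χn , below = rootChildP , λ e →
  χ (child n e 0) , rootChildP-correct χ (n , χn , below) e , mk⇔ (halts e) (reaches e)
  where
  open IsComponent component
  halts : ∀ e → χ (child n e 0) ≡ true → ∅′ e
  halts e χc with InBranch-path (here 0) (connected (child n e 0) n χc χn)
  ... | inj₁ nInBranch = ⊥-elim (<-irrefl refl (InBranch-above nInBranch))
  ... | inj₂ h         = h
  reaches : ∀ e → ∅′ e → χ (child n e 0) ≡ true
  reaches e h with haltsWithin-complete e h
  ... | s , hs = closed n (child n e 0) χn (halting⇒path n e s hs)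

corollary2p2 : ∃[ E ] (ComputableGraph E ×
                 ((χ : ℕ → Bool) → IsComponent E (λ x → χ x ≡ true) → Computes χ ∅′))
corollary2p2 = edge , edge-computable , component-computes-∅′
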